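{- Let $p$ be a prime and let $m,n,\ell$ be integers with $n\ge1$ and $n>m$. Let $r$ be any integer with $r\equiv n\pmod p$. Then $p^2\mid r^n+\ell(r-m)^{n-m}$ if and only if $p^2\mid n^n+\ell(n-m)^{n-m}$. -}

module Defs where

-- Write r = n + d with p ∣ d.  To first order in d, (e + d) ^ e ≡ e ^ e * (1 + d) modulo d²,
-- because the linear term of the binomial expansion is e · e ^ (e - 1) · d = e ^ e · d.
-- Applied to e = n and e = n - m (note r - m = (n - m) + d), this gives
--   r ^ n + ℓ (r - m) ^ (n - m) ≡ (n ^ n + ℓ (n - m) ^ (n - m)) (1 + d)   (mod p²),
-- and 1 + d is a unit modulo p², with inverse 1 - d.
module Submission where

open import Defs
open import Data.Nat using (ℕ) renaming (_*_ to _*ℕ_)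
open import Data.Nat.Primality using (Prime)
open import Data.Integer using (ℤ; +_; _+_; _-_; _*_; _^_; ∣_∣; _≤_; _<_)
open import Data.Integer.Divisibility using (_∣_)
open import Function.Bundles using (_⇔_; mk⇔; Equivalence)

open import Data.Nat using (zero; suc)
open import Data.Nat.Divisibility using (*-pres-∣) renaming (_∣_ to _∣ℕ_)
open import Data.Integer using (+[1+_]; 0ℤ; 1ℤ; -_; +≤+)
open import Data.Integer.Properties using (abs-*; +-monoˡ-≤; i<j⇒suc[i]≤j)
import Data.Integer.Divisibility.Signed as Signed
open Signed using (∣ᵤ⇒∣; ∣⇒∣ᵤ; ∣m∣n⇒∣m+n; ∣m⇒∣m*n; ∣n⇒∣m*n)
open import Data.Integer.Tactic.RingSolver using (solve-∀)
open import Data.Product using (∃-syntax; _,_)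
open import Function using (_∘_)
open import Relation.Binary.PropositionalEquality using (_≡_; refl; sym; trans; cong; subst; module ≡-Reasoning)

binomial-first-order : ∀ x d k →
  ∃[ q ] (x + d) ^ suc k ≡ x ^ suc k + + suc k * x ^ k * d + q * (d * d)
binomial-first-order x d zero = 0ℤ , base x d
  where
  base : ∀ x d → (x + d) * 1ℤ ≡ x * 1ℤ + 1ℤ * 1ℤ * d + 0ℤ * (d * d)
  base = solve-∀
binomial-first-order x d (suc k) with binomial-first-order x d k
... | q , expand = x * q + + suc k * x ^ k + q * d , (begin
  (x + d) * (x + d) ^ suc k
    ≡⟨ cong ((x + d) *_) expand ⟩
  (x + d) * (x ^ suc k + + suc k * x ^ k * d + q * (d * d))
    ≡⟨ step x d (x ^ k) q (+ suc k) ⟩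
  x * x ^ suc k + (1ℤ + + suc k) * x ^ suc k * d + (x * q + + suc k * x ^ k + q * d) * (d * d)
    ∎)
  where
  open ≡-Reasoning
  step : ∀ x d X q c →
    (x + d) * (x * X + c * X * d + q * (d * d))
      ≡ x * (x * X) + (1ℤ + c) * (x * X) * d + (x * q + c * X + q * d) * (d * d)
  step = solve-∀

self-power-first-order : ∀ e d → + 1 ≤ e →
  ∃[ q ] (e + d) ^ ∣ e ∣ ≡ e ^ ∣ e ∣ * (1ℤ + d) + q * (d * d)
self-power-first-order (+ 0) d (+≤+ ())
self-power-first-order +[1+ k ] d _ with binomial-first-order +[1+ k ] d k
... | q , expand = q , (begin
  (+[1+ k ] + d) ^ suc k
    ≡⟨ expand ⟩
  +[1+ k ] ^ suc k + +[1+ k ] * +[1+ k ] ^ k * d + q * (d * d)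
    ≡⟨ factor (+[1+ k ] ^ suc k) d q ⟩
  +[1+ k ] ^ suc k * (1ℤ + d) + q * (d * d)
    ∎)
  where
  open ≡-Reasoning
  factor : ∀ A d q → A + A * d + q * (d * d) ≡ A * (1ℤ + d) + q * (d * d)
  factor = solve-∀

∣⇔∣-up-to-unit-1+d : ∀ {M d A B} q → M Signed.∣ d * d →
  A ≡ B * (1ℤ + d) + q * (d * d) → (M Signed.∣ A ⇔ M Signed.∣ B)
∣⇔∣-up-to-unit-1+d {M} {d} {B = B} q M∣d² refl = mk⇔ to from
  where
  from : M Signed.∣ B → M Signed.∣ B * (1ℤ + d) + q * (d * d)
  from M∣B = ∣m∣n⇒∣m+n (∣m⇒∣m*n (1ℤ + d) M∣B) (∣n⇒∣m*n q M∣d²)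

  invert : ∀ B d q →
    (B * (1ℤ + d) + q * (d * d)) * (1ℤ - d) + (B - q * (1ℤ - d)) * (d * d) ≡ B
  invert = solve-∀

  to : M Signed.∣ B * (1ℤ + d) + q * (d * d) → M Signed.∣ B
  to M∣A = subst (M Signed.∣_) (invert B d q)
    (∣m∣n⇒∣m+n (∣m⇒∣m*n (1ℤ - d) M∣A) (∣n⇒∣m*n (B - q * (1ℤ - d)) M∣d²))

first-order-linear-combination : ∀ {X₁ X₂} A₁ A₂ q₁ q₂ ℓ d →
  X₁ ≡ A₁ * (1ℤ + d) + q₁ * (d * d) → X₂ ≡ A₂ * (1ℤ + d) + q₂ * (d * d) →
  X₁ + ℓ * X₂ ≡ (A₁ + ℓ * A₂) * (1ℤ + d) + (q₁ + ℓ * q₂) * (d * d)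
first-order-linear-combination A₁ A₂ q₁ q₂ ℓ d refl refl = collect A₁ A₂ ℓ d q₁ q₂
  where
  collect : ∀ A₁ A₂ ℓ d q₁ q₂ →
    A₁ * (1ℤ + d) + q₁ * (d * d) + ℓ * (A₂ * (1ℤ + d) + q₂ * (d * d))
      ≡ (A₁ + ℓ * A₂) * (1ℤ + d) + (q₁ + ℓ * q₂) * (d * d)
  collect = solve-∀

∣⇒square∣square : ∀ {p d} → + p ∣ d → + (p *ℕ p) ∣ d * d
∣⇒square∣square {d = d} p∣d = subst (_ ∣ℕ_) (sym (abs-* d d)) (*-pres-∣ p∣d p∣d)

m<n⇒1≤n-m : ∀ {m n} → m < n → + 1 ≤ n - m
m<n⇒1≤n-m {m} {n} m<n = subst (_≤ n - m) (cancel m) (+-monoˡ-≤ (- m) (i<j⇒suc[i]≤j m<n))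
  where
  cancel : ∀ m → 1ℤ + m - m ≡ + 1
  cancel = solve-∀

lemma3p2 : (p : ℕ) → Prime p → (m n ℓ r : ℤ) → + 1 ≤ n → m < n
           → (+ p) ∣ (r - n)
           → ((+ (p *ℕ p)) ∣ (r ^ ∣ n ∣ + ℓ * (r - m) ^ ∣ n - m ∣))
             ⇔ ((+ (p *ℕ p)) ∣ (n ^ ∣ n ∣ + ℓ * (n - m) ^ ∣ n - m ∣))
lemma3p2 p _ m n ℓ r 1≤n m<n p∣d
  with self-power-first-order n (r - n) 1≤n
     | self-power-first-order (n - m) (r - n) (m<n⇒1≤n-m m<n)
... | q₁ , expand₁ | q₂ , expand₂ = mk⇔ (∣⇒∣ᵤ ∘ to ∘ ∣ᵤ⇒∣) (∣⇒∣ᵤ ∘ from ∘ ∣ᵤ⇒∣)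
  where
  d = r - n

  Aᵣ = r ^ ∣ n ∣ + ℓ * (r - m) ^ ∣ n - m ∣
  Aₙ = n ^ ∣ n ∣ + ℓ * (n - m) ^ ∣ n - m ∣

  expansion : Aᵣ ≡ Aₙ * (1ℤ + d) + (q₁ + ℓ * q₂) * (d * d)
  expansion = first-order-linear-combination (n ^ ∣ n ∣) ((n - m) ^ ∣ n - m ∣) q₁ q₂ ℓ d
    (trans (cong (_^ ∣ n ∣) (r≡n+[r-n] n r)) expand₁)
    (trans (cong (_^ ∣ n - m ∣) (r-m≡n-m+[r-n] n m r)) expand₂)
    where
    r≡n+[r-n] : ∀ n r → r ≡ n + (r - n)
    r≡n+[r-n] = solve-∀
    r-m≡n-m+[r-n] : ∀ n m r → r - m ≡ n - m + (r - n)
    r-m≡n-m+[r-n] = solve-∀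

  p²∣d² : + (p *ℕ p) Signed.∣ d * d
  p²∣d² = ∣ᵤ⇒∣ (∣⇒square∣square {d = d} p∣d)

  p²∣Aᵣ⇔p²∣Aₙ : + (p *ℕ p) Signed.∣ Aᵣ ⇔ + (p *ℕ p) Signed.∣ Aₙ
  p²∣Aᵣ⇔p²∣Aₙ = ∣⇔∣-up-to-unit-1+d {d = d} (q₁ + ℓ * q₂) p²∣d² expansion

  open Equivalence p²∣Aᵣ⇔p²∣Aₙ
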